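{- For every decreasing tableau $P$ and $m\in\mathbb{Z}_{>0}$, the insertion $\Phi(P,m)=(P',(r,c),\alpha)$ is well-defined; in particular the output $P'$ is a decreasing tableau.
   Context: Tableaux use English notation; cell $(i,j)$ is in row $i$, column $j$. A decreasing tableau is a filling of the diagram of a partition by positive integers strictly decreasing from left to right along rows and from top to bottom along columns. $P_{>r}$ denotes the tableau obtained by deleting the first $r$ rows of $P$ (rows renumbered from 1). A value $x$ is $P$-ejectable if $x$ occurs in the first row of $P$ and either $x-1$ does not occur in the first row, or $x-1$ occurs in the first row and $x-1$ is $P_{>1}$-ejectable (nothing is ejectable in the empty tableau). Insertion $\Phi(P,m)=(P',(r,c),\alpha)$: set $P':=P$, $N:=m$, $i:=1$. At iteration $i$, let $R$ be the set of entries of row $i$ of $P$ (empty if no such row), $n_1$ the largest element of $R$ with $n_1\le N$. (T1) If $n_1$ does not exist, append $N$ at the end of row $i$ of $P'$ and output $(P',\text{new cell},1)$. Otherwise replace $n_1$ in row $i$ of $P'$ by $N$, and: (D) if $n_1=N$ and $N-1\in R$, set $N:=N-1$, go to iteration $i+1$; (DR) else if $n_1<N$ and $n_1$ is not $P_{>i}$-ejectable, set $N:=n_1$, go to iteration $i+1$; otherwise let $n_2$ be the entry immediately right of $n_1$ in row $i$ of $P$ ($0$ if none) and $y$ the largest $P_{>i}$-ejectable value with $n_2<y<n_1$: (IR1) if $y$ exists, $N:=y$, go to iteration $i+1$; (IR2) if not and $n_2>0$, $N:=n_2$, go to iteration $i+1$; (T2) if not and $n_2=0$, output $(P',\text{the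 cell of } N \text{ in row } i,0)$. -}

module Defs where

open import Data.Nat using (ℕ; zero; suc; _+_; _∸_; _<_; _≤_; _≡ᵇ_; _<ᵇ_; _≤ᵇ_; _⊔_)
open import Data.Bool using (Bool; true; false; _∧_; _∨_; not; if_then_else_; T)
open import Data.List using (List; []; _∷_; _++_; [_]; length; map; foldr)
open import Data.Bool.ListAction using (any)
open import Data.List.Relation.Unary.All using (All)
open import Data.List.Relation.Unary.Linked using (Linked)
open import Data.Maybe using (Maybe; just; nothing)
open import Data.Product using (_×_; _,_; proj₁; proj₂; Σ)
open import Data.Unit using (⊤)
open import Data.Empty using (⊥)
open import Relation.Binary.PropositionalEquality using (_≡_; _≢_)

-- Tableaux: a tableau is the list of its rows (row 1 first), each row
-- the list of its entries from left to right (English notation).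

Row : Set
Row = List ℕ

Tableau : Set
Tableau = List Row

ColDec : Row → Row → Set
ColDec _ [] = ⊤
ColDec [] (_ ∷ _) = ⊥
ColDec (a ∷ R) (b ∷ S) = (b < a) × ColDec R S

_>_ : ℕ → ℕ → Set
a > b = b < a

record IsDecreasingTableau (P : Tableau) : Set where
  field
    rowsNonempty : All (λ R → R ≢ []) P
    positive     : All (All (λ x → 0 < x)) P
    rowsDec      : All (Linked _>_) P
    colsDec      : Linked ColDec P

memᵇ : ℕ → Row → Bool
memᵇ x R = any (λ y → y ≡ᵇ x) R

filterᵇ : (ℕ → Bool) → List ℕ → List ℕ
filterᵇ p [] = []
filterᵇ p (x ∷ xs) = if p x then x ∷ filterᵇ p xs else filterᵇ p xs

maxMaybe : List ℕ → Maybe ℕ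
maxMaybe [] = nothing
maxMaybe (x ∷ xs) with maxMaybe xs
... | nothing = just x
... | just m  = just (x ⊔ m)

largestLE : ℕ → Row → Maybe ℕ
largestLE N R = maxMaybe (filterᵇ (λ x → x ≤ᵇ N) R)

replace : ℕ → ℕ → Row → Row
replace n N = map (λ x → if x ≡ᵇ n then N else x)

indexOf : ℕ → Row → ℕ
indexOf n [] = 0
indexOf n (x ∷ R) = if x ≡ᵇ n then 0 else suc (indexOf n R)

-- entry immediately to the right of (the first occurrence of) n, 0 if none
rightOf : ℕ → Row → ℕ
rightOf n [] = 0
rightOf n (x ∷ []) = 0
rightOf n (x ∷ y ∷ R) = if x ≡ᵇ n then y else rightOf n (y ∷ R)

ejectable : Tableau → ℕ → Bool
ejectable [] x = false
ejectable (R ∷ P) x =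
  memᵇ x R ∧ (not (memᵇ (x ∸ 1) R) ∨ (memᵇ (x ∸ 1) R ∧ ejectable P (x ∸ 1)))

firstRow : Tableau → Row
firstRow [] = []
firstRow (S ∷ _) = S

-- The insertion Φ.
-- Output: (P', (r , c), α) with cells 1-based (row r, column c).

Output : Set
Output = Tableau × (ℕ × ℕ) × ℕ

private
  consRow : Row → Output → Output
  consRow R' (P , cell , α) = (R' ∷ P , cell , α)

-- go i Q N : iteration i, where Q = P_{>i-1} (rows i, i+1, … of P, which
-- are also the rows i, i+1, … of the current P'), and N the current value.
-- Returns the rows i, i+1, … of the final P' together with the cell and α.
go : ℕ → Tableau → ℕ → Output
-- row i does not exist: R = ∅, so (T1)
go i [] N = ([ N ] ∷ [] , (i , 1) , 1)
go i (R ∷ Q) N with largestLE N R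
-- (T1)
... | nothing = ((R ++ [ N ]) ∷ Q , (i , suc (length R)) , 1)
... | just n₁ =
  if (n₁ ≡ᵇ N) ∧ memᵇ (N ∸ 1) R
    then consRow R' (go (suc i) Q (N ∸ 1))                           -- (D)
    else if (n₁ <ᵇ N) ∧ not (ejectable Q n₁)
      then consRow R' (go (suc i) Q n₁)                              -- (DR)
      else yStep (maxMaybe (filterᵇ (λ y → (n₂ <ᵇ y) ∧ (y <ᵇ n₁) ∧ ejectable Q y) candidates))
  where
    R' : Row
    R' = replace n₁ N R
    n₂ : ℕ
    n₂ = rightOf n₁ R
    -- every P_{>i}-ejectable value lies in the first row of P_{>i}
    candidates : List ℕ
    candidates = firstRow Q
    yStep : Maybe ℕ → Output
    yStep (just y) = consRow R' (go (suc i) Q y)                     -- (IR1)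
    yStep nothing =
      if 0 <ᵇ n₂
        then consRow R' (go (suc i) Q n₂)                            -- (IR2)
        else (R' ∷ Q , (i , suc (indexOf n₁ R)) , 0)                  -- (T2)

Φ : Tableau → ℕ → Output
Φ P m = go 1 P m

IsCell : Tableau → ℕ × ℕ → Set
IsCell [] _ = ⊥
IsCell (R ∷ P) (zero , c) = ⊥
IsCell (R ∷ P) (suc zero , c) = (1 ≤ c) × (c ≤ length R)
IsCell (R ∷ P) (suc (suc r) , c) = IsCell P (suc r , c)

-- In every branch of Φ, row i of P′ is rowInsert N (row i of P): the largest entry
-- n₁ ≤ N is overwritten by N, or N is appended.  This keeps the row decreasing and
-- only increases entries, so the column condition can fail only against the next row,
-- into which the next value N′ is inserted.  That condition holds as soon as N′ < N
-- and the entry s of row i+1 below the slot of n₁ satisfies s ≤ N′, for then N′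
-- lands weakly left of that slot.  As s < n₁ this is immediate in (D) and (DR).  In
-- (IR1) and (IR2), with n₂ the right neighbour of n₁, either s ≤ n₂ ≤ N′, or
-- n₂ < s < n₁; then s − 1 is not in row i+1 (the entry after s is below n₂), so s is
-- P_{>i}-ejectable, hence a candidate y: this gives s ≤ y in (IR1) and is impossible
-- in (IR2).

module Submission where

open import Defs
open import Data.Bool using (Bool; true; false; _∧_; _∨_; not; T)
open import Data.Bool.Properties using (∨-zeroʳ)
open import Data.List using (List; []; _∷_; _++_; [_]; length)
open import Data.List.Properties using (length-++; length-map)
open import Data.List.Relation.Unary.All as All using (All; []; _∷_)
open import Data.List.Relation.Unary.Linked as Linked using (Linked; []; [-]; _∷_)
open import Data.List.Relation.Unary.Linked.Properties using (Linked⇒All)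
open import Data.Maybe using (Maybe; just; nothing)
open import Data.Nat using (ℕ; suc; _+_; _∸_; _<_; _≤_; _≡ᵇ_; _<ᵇ_; _≤ᵇ_; _⊔_; z≤n; s≤s; z<s; _≤?_; _≟_)
open import Data.Nat.Properties
open import Data.Product using (_×_; _,_; proj₁; proj₂)
open import Data.Sum as Sum using (_⊎_; inj₁; inj₂; [_,_]′)
open import Function using (id)
open import Relation.Binary.PropositionalEquality using (_≡_; _≢_; refl; sym; trans; cong; subst)
open import Relation.Nullary using (yes; no; contradiction)

T⇒≡true : ∀ {b} → T b → b ≡ true
T⇒≡true {true} _ = refl

≡true⇒T : ∀ {b} → b ≡ true → T b
≡true⇒T refl = _

∧-true⁻ : ∀ {a b} → (a ∧ b) ≡ true → a ≡ true × b ≡ true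
∧-true⁻ {true} e = refl , e

∨-true⁻ : ∀ {a b} → (a ∨ b) ≡ true → a ≡ true ⊎ b ≡ true
∨-true⁻ {true}  _ = inj₁ refl
∨-true⁻ {false} e = inj₂ e

≡ᵇ-refl : ∀ m → (m ≡ᵇ m) ≡ true
≡ᵇ-refl m = T⇒≡true (≡⇒≡ᵇ m m refl)

≡ᵇ-true⇒≡ : ∀ {m n} → (m ≡ᵇ n) ≡ true → m ≡ n
≡ᵇ-true⇒≡ {m} {n} e = ≡ᵇ⇒≡ m n (≡true⇒T e)

≢⇒≡ᵇ-false : ∀ {m n} → m ≢ n → (m ≡ᵇ n) ≡ false
≢⇒≡ᵇ-false {m} {n} m≢n with m ≡ᵇ n in e
... | false = refl
... | true  = contradiction (≡ᵇ-true⇒≡ e) m≢n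

≤⇒≤ᵇ-true : ∀ {m n} → m ≤ n → (m ≤ᵇ n) ≡ true
≤⇒≤ᵇ-true m≤n = T⇒≡true (≤⇒≤ᵇ m≤n)

>⇒≤ᵇ-false : ∀ {m n} → n < m → (m ≤ᵇ n) ≡ false
>⇒≤ᵇ-false {m} {n} n<m with m ≤ᵇ n in e
... | false = refl
... | true  = contradiction (≤ᵇ⇒≤ m n (≡true⇒T e)) (<⇒≱ n<m)

<⇒<ᵇ-true : ∀ {m n} → m < n → (m <ᵇ n) ≡ true
<⇒<ᵇ-true m<n = T⇒≡true (<⇒<ᵇ m<n)

<ᵇ-true⇒< : ∀ {m n} → (m <ᵇ n) ≡ true → m < n
<ᵇ-true⇒< {m} {n} e = <ᵇ⇒< m n (≡true⇒T e)

<⇒≤∸1 : ∀ {m n} → m < n → m ≤ n ∸ 1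
<⇒≤∸1 (s≤s m≤n) = m≤n

∸1< : ∀ {n} → 0 < n → n ∸ 1 < n
∸1< {suc n} _ = n<1+n n

memᵇ-here : ∀ x R → memᵇ x (x ∷ R) ≡ true
memᵇ-here x R rewrite ≡ᵇ-refl x = refl

memᵇ-there : ∀ {x} y R → memᵇ x R ≡ true → memᵇ x (y ∷ R) ≡ true
memᵇ-there {x} y R x∈R rewrite x∈R = ∨-zeroʳ (y ≡ᵇ x)

memᵇ-∷-≢ : ∀ {x y} R → y ≢ x → memᵇ x (y ∷ R) ≡ memᵇ x R
memᵇ-∷-≢ R y≢x rewrite ≢⇒≡ᵇ-false y≢x = refl

memᵇ-All : ∀ {P : ℕ → Set} {x R} → All P R → memᵇ x R ≡ true → P x
memᵇ-All {P} {x} (_∷_ {y} py ps) x∈yR with ∨-true⁻ {y ≡ᵇ x} x∈yR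
... | inj₁ y≡x = subst P (≡ᵇ-true⇒≡ y≡x) py
... | inj₂ x∈R = memᵇ-All ps x∈R

All≢⇒memᵇ-false : ∀ {x R} → All (_≢ x) R → memᵇ x R ≡ false
All≢⇒memᵇ-false []           = refl
All≢⇒memᵇ-false (y≢x ∷ ps) rewrite ≢⇒≡ᵇ-false y≢x = All≢⇒memᵇ-false ps

memᵇ-indexOf : ∀ {n} R → memᵇ n R ≡ true → indexOf n R < length R
memᵇ-indexOf {n} (x ∷ R) n∈xR with x ≡ᵇ n
... | true  = s≤s z≤n
... | false = s≤s (memᵇ-indexOf R n∈xR)

Decreasing : Row → Set
Decreasing = Linked _>_

>-trans : ∀ {a b c} → a > b → b > c → a > c
>-trans a>b b>c = <-trans b>c a>b

head>tail : ∀ {r R} → Decreasing (r ∷ R) → All (_< r) R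
head>tail [-]        = []
head>tail (r>x ∷ d) = Linked⇒All >-trans r>x d

head-weaken : ∀ {r N R} → Decreasing (r ∷ R) → r ≤ N → Decreasing (N ∷ R)
head-weaken [-]        _   = [-]
head-weaken (r>x ∷ d) r≤N = <-≤-trans r>x r≤N ∷ d

maxMaybe-nothing-∉ : ∀ L {x} → maxMaybe L ≡ nothing → memᵇ x L ≢ true
maxMaybe-nothing-∉ []       _ ()
maxMaybe-nothing-∉ (x ∷ xs) e with maxMaybe xs
maxMaybe-nothing-∉ (x ∷ xs) () | nothing
maxMaybe-nothing-∉ (x ∷ xs) () | just _

maxMaybe-mem : ∀ L {m} → maxMaybe L ≡ just m → memᵇ m L ≡ true
maxMaybe-mem (x ∷ xs) e with maxMaybe xs in e′
maxMaybe-mem (x ∷ xs) refl | nothing = memᵇ-here x xs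
maxMaybe-mem (x ∷ xs) refl | just m with ⊔-sel x m
... | inj₁ x⊔m≡x rewrite x⊔m≡x = memᵇ-here x xs
... | inj₂ x⊔m≡m rewrite x⊔m≡m = memᵇ-there x xs (maxMaybe-mem xs e′)

maxMaybe-upper : ∀ L {m x} → maxMaybe L ≡ just m → memᵇ x L ≡ true → x ≤ m
maxMaybe-upper (y ∷ ys) {x = x} e x∈yys with maxMaybe ys in e′ | ∨-true⁻ {y ≡ᵇ x} x∈yys
maxMaybe-upper (y ∷ ys) refl _ | nothing | inj₁ y≡x = ≤-reflexive (sym (≡ᵇ-true⇒≡ y≡x))
maxMaybe-upper (y ∷ ys) refl _ | nothing | inj₂ x∈ys = contradiction x∈ys (maxMaybe-nothing-∉ ys e′)
maxMaybe-upper (y ∷ ys) refl _ | just m | inj₁ y≡x =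
  subst (_≤ y ⊔ m) (≡ᵇ-true⇒≡ y≡x) (m≤m⊔n y m)
maxMaybe-upper (y ∷ ys) refl _ | just m | inj₂ x∈ys =
  ≤-trans (maxMaybe-upper ys e′ x∈ys) (m≤n⊔m y m)

maxMaybe-head : ∀ {r R} → Decreasing (r ∷ R) → maxMaybe (r ∷ R) ≡ just r
maxMaybe-head [-] = refl
maxMaybe-head {r} (r>x ∷ d) rewrite maxMaybe-head d = cong just (m≥n⇒m⊔n≡m (<⇒≤ r>x))

filterᵇ-mem⁺ : ∀ (p : ℕ → Bool) L {x} → memᵇ x L ≡ true → p x ≡ true →
  memᵇ x (filterᵇ p L) ≡ true
filterᵇ-mem⁺ p (y ∷ ys) {x} x∈yys px with y ≟ x
... | yes refl rewrite px = memᵇ-here y (filterᵇ p ys)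
... | no y≢x with p y | filterᵇ-mem⁺ p ys (trans (sym (memᵇ-∷-≢ ys y≢x)) x∈yys) px
...   | true  | x∈f = memᵇ-there y (filterᵇ p ys) x∈f
...   | false | x∈f = x∈f

filterᵇ-mem⁻ : ∀ (p : ℕ → Bool) L {x} → memᵇ x (filterᵇ p L) ≡ true →
  p x ≡ true × memᵇ x L ≡ true
filterᵇ-mem⁻ p (y ∷ ys) {x} x∈f with y ≟ x | p y in py
... | yes refl | true  = py , memᵇ-here y ys
... | _        | false = let px , x∈ys = filterᵇ-mem⁻ p ys x∈f in px , memᵇ-there y ys x∈ys
... | no y≢x   | true  =
  let px , x∈ys = filterᵇ-mem⁻ p ys (trans (sym (memᵇ-∷-≢ (filterᵇ p ys) y≢x)) x∈f)
  in px , memᵇ-there y ys x∈ys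

filterᵇ-all : ∀ (p : ℕ → Bool) L → All (λ x → p x ≡ true) L → filterᵇ p L ≡ L
filterᵇ-all p []       []         = refl
filterᵇ-all p (y ∷ ys) (py ∷ ps) rewrite py = cong (y ∷_) (filterᵇ-all p ys ps)

maxMaybe-filterᵇ : ∀ (p : ℕ → Bool) L {m} → maxMaybe (filterᵇ p L) ≡ just m →
  p m ≡ true × memᵇ m L ≡ true
maxMaybe-filterᵇ p L e = filterᵇ-mem⁻ p L (maxMaybe-mem (filterᵇ p L) e)

largestLE-mem : ∀ {N} R {n} → largestLE N R ≡ just n → memᵇ n R ≡ true
largestLE-mem R e = proj₂ (maxMaybe-filterᵇ _ R e)

largestLE-≤ : ∀ {N} R {n} → largestLE N R ≡ just n → n ≤ N
largestLE-≤ {N} R {n} e = ≤ᵇ⇒≤ n N (≡true⇒T (proj₁ (maxMaybe-filterᵇ _ R e)))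

largestLE-head : ∀ {N r R} → Decreasing (r ∷ R) → r ≤ N → largestLE N (r ∷ R) ≡ just r
largestLE-head {N} {R = R} d r≤N
  rewrite ≤⇒≤ᵇ-true r≤N
        | filterᵇ-all (_≤ᵇ N) R (All.map (λ x<r → ≤⇒≤ᵇ-true (≤-trans (<⇒≤ x<r) r≤N)) (head>tail d))
  = maxMaybe-head d

largestLE-tail : ∀ {N r} R → N < r → largestLE N (r ∷ R) ≡ largestLE N R
largestLE-tail R N<r rewrite >⇒≤ᵇ-false N<r = refl

rowInsert : ℕ → Row → Row
rowInsert N []      = N ∷ []
rowInsert N (r ∷ R) with r ≤? N
... | yes _ = N ∷ R
... | no  _ = r ∷ rowInsert N R

rowInsert-append : ∀ {N} R → Decreasing R → largestLE N R ≡ nothing → R ++ [ N ] ≡ rowInsert N R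
rowInsert-append []      _ _ = refl
rowInsert-append {N} (r ∷ R) d e with r ≤? N
... | yes r≤N with () ← trans (sym (largestLE-head d r≤N)) e
... | no  r≰N =
  cong (r ∷_) (rowInsert-append R (Linked.tail d) (trans (sym (largestLE-tail R (≰⇒> r≰N))) e))

replace-absent : ∀ {n N} R → All (_< n) R → replace n N R ≡ R
replace-absent []      []          = refl
replace-absent (x ∷ R) (x<n ∷ ps) rewrite ≢⇒≡ᵇ-false (<⇒≢ x<n) = cong (x ∷_) (replace-absent R ps)

replace-largestLE : ∀ {N n} R → Decreasing R → largestLE N R ≡ just n → replace n N R ≡ rowInsert N R
replace-largestLE {N} (r ∷ R) d e with r ≤? N
... | yes r≤N with refl ← trans (sym (largestLE-head d r≤N)) e rewrite ≡ᵇ-refl r =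
  cong (N ∷_) (replace-absent R (head>tail d))
... | no r≰N rewrite ≢⇒≡ᵇ-false (>⇒≢ (≤-<-trans (largestLE-≤ (r ∷ R) e) (≰⇒> r≰N))) =
  cong (r ∷_) (replace-largestLE R (Linked.tail d) (trans (sym (largestLE-tail R (≰⇒> r≰N))) e))

rowInsert-nonempty : ∀ N R → rowInsert N R ≢ []
rowInsert-nonempty N []      ()
rowInsert-nonempty N (r ∷ R) with r ≤? N
... | yes _ = λ ()
... | no  _ = λ ()

rowInsert-positive : ∀ {N} R → 0 < N → All (0 <_) R → All (0 <_) (rowInsert N R)
rowInsert-positive      []      0<N []           = 0<N ∷ []
rowInsert-positive {N} (r ∷ R) 0<N (0<r ∷ pos) with r ≤? N
... | yes _ = 0<N ∷ pos
... | no  _ = 0<r ∷ rowInsert-positive R 0<N pos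

rowInsert-decreasing-∷ : ∀ {N x} R → N < x → Decreasing (x ∷ R) → Decreasing (x ∷ rowInsert N R)
rowInsert-decreasing-∷      []      N<x [-]          = N<x ∷ [-]
rowInsert-decreasing-∷ {N} (r ∷ R) N<x (x>r ∷ d) with r ≤? N
... | yes r≤N = N<x ∷ head-weaken d r≤N
... | no  r≰N = x>r ∷ rowInsert-decreasing-∷ R (≰⇒> r≰N) d

rowInsert-decreasing : ∀ {N} R → Decreasing R → Decreasing (rowInsert N R)
rowInsert-decreasing      []      _ = [-]
rowInsert-decreasing {N} (r ∷ R) d with r ≤? N
... | yes r≤N = head-weaken d r≤N
... | no  r≰N = rowInsert-decreasing-∷ R (≰⇒> r≰N) d

ColDec-rowInsertˡ : ∀ {N} R S → ColDec R S → ColDec (rowInsert N R) S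
ColDec-rowInsertˡ      R       []      _       = _
ColDec-rowInsertˡ {N} (r ∷ R) (s ∷ S) (s<r , c) with r ≤? N
... | yes r≤N = <-≤-trans s<r r≤N , c
... | no  _   = s<r , ColDec-rowInsertˡ R S c

-- The entry of S directly below the cell of R that rowInsert N overwrites.
entryBelowSlot : ℕ → Row → Row → Maybe ℕ
entryBelowSlot N []      _       = nothing
entryBelowSlot N (r ∷ R) []      = nothing
entryBelowSlot N (r ∷ R) (s ∷ S) with r ≤? N
... | yes _ = just s
... | no  _ = entryBelowSlot N R S

ColDec-rowInsert : ∀ {N N′} R S → ColDec R S → N′ < N →
  (∀ {s} → entryBelowSlot N R S ≡ just s → s ≤ N′) → ColDec (rowInsert N R) (rowInsert N′ S)
ColDec-rowInsert       []      []      _ N′<N _ = N′<N , _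
ColDec-rowInsert {N}  (r ∷ R) []      _ N′<N _ with r ≤? N
... | yes _   = N′<N , _
... | no  r≰N = <-trans N′<N (≰⇒> r≰N) , _
ColDec-rowInsert {N} {N′} (r ∷ R) (s ∷ S) (s<r , c) N′<N fits with r ≤? N | s ≤? N′
... | yes _   | yes _   = N′<N , c
... | yes _   | no  s≰N′ = contradiction (fits refl) s≰N′
... | no  r≰N | yes _   = <-trans N′<N (≰⇒> r≰N) , ColDec-rowInsertˡ R S c
... | no  _   | no  _   = s<r , ColDec-rowInsert R S c N′<N fits

entryBelowSlot-mem : ∀ {N s} R S → entryBelowSlot N R S ≡ just s → memᵇ s S ≡ true
entryBelowSlot-mem {N} (r ∷ R) (s′ ∷ S) e with r ≤? N
... | yes _ with refl ← e = memᵇ-here s′ S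
... | no  _ = memᵇ-there s′ S (entryBelowSlot-mem R S e)

entryBelowSlot-< : ∀ {N n₁ s} R S → Decreasing R → ColDec R S →
  largestLE N R ≡ just n₁ → entryBelowSlot N R S ≡ just s → s < n₁
entryBelowSlot-< {N} (r ∷ R) (s′ ∷ S) d (s′<r , c) eL e with r ≤? N
... | yes r≤N with refl ← e | refl ← trans (sym (largestLE-head d r≤N)) eL = s′<r
... | no  r≰N = entryBelowSlot-< R S (Linked.tail d) c (trans (sym (largestLE-tail R (≰⇒> r≰N))) eL) e

rightOf-∷ : ∀ {n r} R → r ≢ n → memᵇ n R ≡ true → rightOf n (r ∷ R) ≡ rightOf n R
rightOf-∷ (r′ ∷ R) r≢n _ rewrite ≢⇒≡ᵇ-false r≢n = refl

rightOf-< : ∀ {n} R → Decreasing R → 0 < rightOf n R → rightOf n R < n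
rightOf-< {n} (x ∷ y ∷ R) (x>y ∷ d) 0<n₂ with x ≡ᵇ n in x≡n
... | true  = subst (y <_) (≡ᵇ-true⇒≡ x≡n) x>y
... | false = rightOf-< (y ∷ R) d 0<n₂

-- If s sits below the head r of R and exceeds the entry right of r, then s - 1 cannot
-- occur in S: the entries of S after s are below those of R after r.
gap-below-head : ∀ {r s} R S → ColDec R S → Decreasing (s ∷ S) → 0 < s →
  s ≤ rightOf r (r ∷ R) ⊎ memᵇ (s ∸ 1) (s ∷ S) ≡ false
gap-below-head []       []       _ _ 0<s = inj₂ (All≢⇒memᵇ-false (>⇒≢ (∸1< 0<s) ∷ []))
gap-below-head {r} {s} (r′ ∷ R) S c d 0<s rewrite ≡ᵇ-refl r with s ≤? r′
... | yes s≤r′ = inj₁ s≤r′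
... | no  s≰r′ = inj₂ (All≢⇒memᵇ-false (>⇒≢ (∸1< 0<s) ∷ All.map <⇒≢ (tail<s∸1 S c d)))
  where
  tail<s∸1 : ∀ S → ColDec (r′ ∷ R) S → Decreasing (s ∷ S) → All (_< s ∸ 1) S
  tail<s∸1 []        _           _         = []
  tail<s∸1 (s″ ∷ S″) (s″<r′ , _) (_ ∷ d′) = Linked⇒All >-trans (<-≤-trans s″<r′ (<⇒≤∸1 (≰⇒> s≰r′))) d′

entryBelowSlot-gap : ∀ {N n₁ s} R S → Decreasing R → Decreasing S → All (0 <_) S → ColDec R S →
  largestLE N R ≡ just n₁ → entryBelowSlot N R S ≡ just s →
  s ≤ rightOf n₁ R ⊎ memᵇ (s ∸ 1) S ≡ false
entryBelowSlot-gap {N} {n₁} {s} (r ∷ R) (s′ ∷ S) d dS (0<s′ ∷ pos) (_ , c) eL e with r ≤? N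
... | yes r≤N with refl ← e | refl ← trans (sym (largestLE-head d r≤N)) eL = gap-below-head R S c dS 0<s′
... | no  r≰N =
  Sum.map (λ s≤n₂ → subst (_ ≤_) (sym (rightOf-∷ R r≢n₁ (largestLE-mem R eL′))) s≤n₂)
          (λ fresh → trans (memᵇ-∷-≢ S s′≢s∸1) fresh)
          (entryBelowSlot-gap R S (Linked.tail d) (Linked.tail dS) pos c eL′ e)
  where
  eL′ : largestLE N R ≡ just n₁
  eL′ = trans (sym (largestLE-tail R (≰⇒> r≰N))) eL
  r≢n₁ : r ≢ n₁
  r≢n₁ = >⇒≢ (≤-<-trans (largestLE-≤ R eL′) (≰⇒> r≰N))
  s′≢s∸1 : s′ ≢ s ∸ 1
  s′≢s∸1 = >⇒≢ (≤-<-trans (m∸n≤m _ 1) (memᵇ-All (head>tail dS) (entryBelowSlot-mem R S e)))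

open IsDecreasingTableau

IsDecreasingTableau-tail : ∀ {R Q} → IsDecreasingTableau (R ∷ Q) → IsDecreasingTableau Q
IsDecreasingTableau-tail dt = record
  { rowsNonempty = All.tail (rowsNonempty dt)
  ; positive     = All.tail (positive dt)
  ; rowsDec      = All.tail (rowsDec dt)
  ; colsDec      = Linked.tail (colsDec dt)
  }

firstRow-decreasing : ∀ Q → IsDecreasingTableau Q → Decreasing (firstRow Q)
firstRow-decreasing []      _  = []
firstRow-decreasing (S ∷ Q) dt = All.head (rowsDec dt)

firstRow-positive : ∀ Q → IsDecreasingTableau Q → All (0 <_) (firstRow Q)
firstRow-positive []      _  = []
firstRow-positive (S ∷ Q) dt = All.head (positive dt)

ColDec-firstRow : ∀ {R} Q → Linked ColDec (R ∷ Q) → ColDec R (firstRow Q)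
ColDec-firstRow []      _       = _
ColDec-firstRow (S ∷ Q) (c ∷ _) = c

Linked-∷-firstRow : ∀ {R} P → ColDec R (firstRow P) → Linked ColDec P → Linked ColDec (R ∷ P)
Linked-∷-firstRow []      _ _  = [-]
Linked-∷-firstRow (S ∷ P) c cs = c ∷ cs

IsDecreasingTableau-rowInsert-∷ : ∀ {N R Q P} → IsDecreasingTableau (R ∷ Q) → 0 < N →
  IsDecreasingTableau P → ColDec (rowInsert N R) (firstRow P) → IsDecreasingTableau (rowInsert N R ∷ P)
IsDecreasingTableau-rowInsert-∷ {N} {R} {P = P} dt 0<N dtP c = record
  { rowsNonempty = rowInsert-nonempty N R ∷ rowsNonempty dtP
  ; positive     = rowInsert-positive R 0<N (All.head (positive dt)) ∷ positive dtP
  ; rowsDec      = rowInsert-decreasing R (All.head (rowsDec dt)) ∷ rowsDec dtP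
  ; colsDec      = Linked-∷-firstRow P c (colsDec dtP)
  }

ejectable-fresh : ∀ Q {s} → memᵇ s (firstRow Q) ≡ true → memᵇ (s ∸ 1) (firstRow Q) ≡ false →
  ejectable Q s ≡ true
ejectable-fresh (S ∷ Q) s∈S s∸1∉S rewrite s∈S | s∸1∉S = refl

ejectableBetween : Tableau → ℕ → ℕ → ℕ → Bool
ejectableBetween Q lo hi y = (lo <ᵇ y) ∧ (y <ᵇ hi) ∧ ejectable Q y

ejectableCandidates : Tableau → ℕ → ℕ → List ℕ
ejectableCandidates Q lo hi = filterᵇ (ejectableBetween Q lo hi) (firstRow Q)

maxMaybe-candidates-bounds : ∀ Q lo hi {y} → maxMaybe (ejectableCandidates Q lo hi) ≡ just y →
  lo < y × y < hi
maxMaybe-candidates-bounds Q lo hi e =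
  let lo<y , rest = ∧-true⁻ (proj₁ (maxMaybe-filterᵇ (ejectableBetween Q lo hi) (firstRow Q) e))
  in <ᵇ-true⇒< lo<y , <ᵇ-true⇒< (proj₁ (∧-true⁻ rest))

module _ {N n₁ R Q} (dt : IsDecreasingTableau (R ∷ Q)) (eL : largestLE N R ≡ just n₁) where

  private
    dR : Decreasing R
    dR = All.head (rowsDec dt)

    dtQ : IsDecreasingTableau Q
    dtQ = IsDecreasingTableau-tail dt

    c : ColDec R (firstRow Q)
    c = ColDec-firstRow Q (colsDec dt)

    candidates : List ℕ
    candidates = ejectableCandidates Q (rightOf n₁ R) n₁

  belowSlot-< : ∀ {s} → entryBelowSlot N R (firstRow Q) ≡ just s → s < n₁
  belowSlot-< = entryBelowSlot-< R (firstRow Q) dR c eL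

  belowSlot-candidate : ∀ {s} → entryBelowSlot N R (firstRow Q) ≡ just s →
    s ≤ rightOf n₁ R ⊎ memᵇ s candidates ≡ true
  belowSlot-candidate {s} e with s ≤? rightOf n₁ R
    | entryBelowSlot-gap R (firstRow Q) dR (firstRow-decreasing Q dtQ) (firstRow-positive Q dtQ) c eL e
  ... | yes s≤n₂ | _          = inj₁ s≤n₂
  ... | no  s≰n₂ | inj₁ s≤n₂ = contradiction s≤n₂ s≰n₂
  ... | no  s≰n₂ | inj₂ s∸1∉S = inj₂ (filterᵇ-mem⁺ _ (firstRow Q) s∈S between)
    where
    s∈S : memᵇ s (firstRow Q) ≡ true
    s∈S = entryBelowSlot-mem R (firstRow Q) e
    between : (rightOf n₁ R <ᵇ s) ∧ (s <ᵇ n₁) ∧ ejectable Q s ≡ true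
    between rewrite <⇒<ᵇ-true (≰⇒> s≰n₂) | <⇒<ᵇ-true (belowSlot-< e)
                  | ejectable-fresh Q s∈S s∸1∉S = refl

  belowSlot-≤-max : ∀ {y s} → maxMaybe candidates ≡ just y → entryBelowSlot N R (firstRow Q) ≡ just s →
    s ≤ y
  belowSlot-≤-max {y} eY e =
    [ (λ s≤n₂ → ≤-trans s≤n₂ (<⇒≤ n₂<y)) , maxMaybe-upper candidates eY ]′ (belowSlot-candidate e)
    where
    n₂<y : rightOf n₁ R < y
    n₂<y = proj₁ (maxMaybe-candidates-bounds Q (rightOf n₁ R) n₁ eY)

  belowSlot-≤-rightOf : ∀ {s} → maxMaybe candidates ≡ nothing → entryBelowSlot N R (firstRow Q) ≡ just s →
    s ≤ rightOf n₁ R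
  belowSlot-≤-rightOf eY e =
    [ id , (λ s∈C → contradiction s∈C (maxMaybe-nothing-∉ candidates eY)) ]′ (belowSlot-candidate e)

-- go i returns only the rows from row i on, but the cell with its absolute row index.
record WellInserted (i : ℕ) (Q : Tableau) (N : ℕ) (o : Output) : Set where
  field
    firstRow≡   : firstRow (proj₁ o) ≡ rowInsert N (firstRow Q)
    decreasing  : IsDecreasingTableau (proj₁ o)
    depth       : ℕ
    cellRow≡    : proj₁ (proj₁ (proj₂ o)) ≡ i + depth
    cellInShape : IsCell (proj₁ o) (suc depth , proj₂ (proj₁ (proj₂ o)))

open WellInserted

wellInserted-stop : ∀ {i N R Q R′ c α} → IsDecreasingTableau (R ∷ Q) → 0 < N →
  R′ ≡ rowInsert N R → c < length R′ → WellInserted i (R ∷ Q) N (R′ ∷ Q , (i , suc c) , α)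
wellInserted-stop {i} {R = R} {Q} dt 0<N refl c<∣R′∣ = record
  { firstRow≡   = refl
  ; decreasing  = IsDecreasingTableau-rowInsert-∷ dt 0<N (IsDecreasingTableau-tail dt)
                    (ColDec-rowInsertˡ R (firstRow Q) (ColDec-firstRow Q (colsDec dt)))
  ; depth       = 0
  ; cellRow≡    = sym (+-identityʳ i)
  ; cellInShape = s≤s z≤n , c<∣R′∣
  }

wellInserted-∷ : ∀ {i N N′ n₁ R Q o} → IsDecreasingTableau (R ∷ Q) → 0 < N → largestLE N R ≡ just n₁ →
  N′ < N → (∀ {s} → entryBelowSlot N R (firstRow Q) ≡ just s → s ≤ N′) → WellInserted (suc i) Q N′ o →
  WellInserted i (R ∷ Q) N (replace n₁ N R ∷ proj₁ o , proj₂ o)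
wellInserted-∷ {i} {R = R} {Q} dt 0<N eL N′<N fits w
  rewrite replace-largestLE R (All.head (rowsDec dt)) eL = record
  { firstRow≡   = refl
  ; decreasing  = IsDecreasingTableau-rowInsert-∷ dt 0<N (decreasing w)
                    (subst (ColDec _) (sym (firstRow≡ w))
                      (ColDec-rowInsert R (firstRow Q) (ColDec-firstRow Q (colsDec dt)) N′<N fits))
  ; depth       = suc (depth w)
  ; cellRow≡    = trans (cellRow≡ w) (sym (+-suc i (depth w)))
  ; cellInShape = cellInShape w
  }

go-wellInserted : ∀ i Q N → IsDecreasingTableau Q → 0 < N → WellInserted i Q N (go i Q N)
go-wellInserted i [] N _ 0<N = record
  { firstRow≡   = refl
  ; decreasing  = record
    { rowsNonempty = (λ ()) ∷ [] ; positive = (0<N ∷ []) ∷ [] ; rowsDec = [-] ∷ [] ; colsDec = [-] }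
  ; depth       = 0
  ; cellRow≡    = sym (+-identityʳ i)
  ; cellInShape = ≤-refl , ≤-refl
  }
go-wellInserted i (R ∷ Q) N dt 0<N with largestLE N R in eL
... | nothing = wellInserted-stop dt 0<N (rowInsert-append R (All.head (rowsDec dt)) eL)
                  (subst (length R <_) (sym (length-++ R)) (m<m+n (length R) z<s))
... | just n₁ with (n₁ ≡ᵇ N) ∧ memᵇ (N ∸ 1) R in eD
... | true = let n₁≡N , N∸1∈R = ∧-true⁻ eD in
  wellInserted-∷ dt 0<N eL (∸1< 0<N)
    (λ e → <⇒≤∸1 (subst (_ <_) (≡ᵇ-true⇒≡ n₁≡N) (belowSlot-< dt eL e)))
    (go-wellInserted (suc i) Q (N ∸ 1) (IsDecreasingTableau-tail dt)
      (memᵇ-All (All.head (positive dt)) N∸1∈R))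
... | false with (n₁ <ᵇ N) ∧ not (ejectable Q n₁) in eR
... | true =
  wellInserted-∷ dt 0<N eL (<ᵇ-true⇒< (proj₁ (∧-true⁻ eR)))
    (λ e → <⇒≤ (belowSlot-< dt eL e))
    (go-wellInserted (suc i) Q n₁ (IsDecreasingTableau-tail dt)
      (memᵇ-All (All.head (positive dt)) (largestLE-mem R eL)))
... | false with maxMaybe (ejectableCandidates Q (rightOf n₁ R) n₁) in eY
... | just y = let n₂<y , y<n₁ = maxMaybe-candidates-bounds Q (rightOf n₁ R) n₁ eY in
  wellInserted-∷ dt 0<N eL (<-≤-trans y<n₁ (largestLE-≤ R eL))
    (belowSlot-≤-max dt eL eY)
    (go-wellInserted (suc i) Q y (IsDecreasingTableau-tail dt) (≤-<-trans z≤n n₂<y))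
... | nothing with 0 <ᵇ rightOf n₁ R in e0
... | true = let 0<n₂ = <ᵇ-true⇒< e0 in
  wellInserted-∷ dt 0<N eL (<-≤-trans (rightOf-< R (All.head (rowsDec dt)) 0<n₂) (largestLE-≤ R eL))
    (belowSlot-≤-rightOf dt eL eY)
    (go-wellInserted (suc i) Q (rightOf n₁ R) (IsDecreasingTableau-tail dt) 0<n₂)
... | false = wellInserted-stop dt 0<N (replace-largestLE R (All.head (rowsDec dt)) eL)
                (subst (indexOf n₁ R <_) (sym (length-map _ R)) (memᵇ-indexOf R (largestLE-mem R eL)))

lemma5p2 : (P : Tableau) (m : ℕ) → IsDecreasingTableau P → 0 < m →
    IsDecreasingTableau (proj₁ (Φ P m)) × IsCell (proj₁ (Φ P m)) (proj₁ (proj₂ (Φ P m)))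
lemma5p2 P m dt 0<m =
  decreasing w ,
  subst (λ r → IsCell (proj₁ (Φ P m)) (r , proj₂ (proj₁ (proj₂ (Φ P m))))) (sym (cellRow≡ w)) (cellInShape w)
  where
  w : WellInserted 1 P m (Φ P m)
  w = go-wellInserted 1 P m dt 0<m
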